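{- Let $f_{i,j,k}=m_{i,j,k}F_{3i+j,k}$ for all $i,j\in\mathbb{Z}$ and $k\ge -1$. Then for all $i,j\in\mathbb{Z}$ and $k\ge 0$, $$f_{i,j,k-1}f_{i,j,k+1}=f_{i-1,j,k}f_{i+1,j,k}+f_{i,j-1,k}f_{i,j+1,k},$$ i.e. $(f_{i,j,k})$ is a solution of the octahedron recurrence.
   Context: Fix $n\ge1$ and let $y_j$ ($j\in\mathbb{Z}$) be indeterminates with $y_{j+2n}=y_j$; all quantities lie in $\mathbb{Q}(y_1,\dots,y_{2n})$. Product convention: $\prod_{i=a}^{a-1}z_i=1$ and $\prod_{i=a}^{b}z_i=\prod_{i=b+1}^{a-1}z_i^{ -1}$ for $b<a-1$. Define $m_{i,j,0}=\prod_{l=0}^{j-1}\prod_{m=0}^{l}y_{3i+j-4l+6m-1}$ (with the convention this gives $m_{i,-1,0}=m_{i,0,0}=1$ and $m_{i,j,0}=\prod_{l=j}^{ -2}\prod_{m=l+1}^{ -1}y_{3i+j-4l+6m-1}$ for $j\le -2$), $m_{i,j,-1}=1/m_{i,j,0}$, and $m_{i,j,k}=m_{i-1,j,k-1}m_{i+1,j,k-1}/m_{i,j,k-2}$ for $k\ge1$. Define $F_{j,-1}=F_{j,0}=1$ for all $j$ and, for $k\ge0$, $F_{j,k+1}=\dfrac{F_{j-3,k}F_{j+3,k}+\left(\prod_{i=-k}^{k}y_{j+3i}\right)F_{j-1,k}F_{j+1,k}}{F_{j,k-1}}$. -}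

module Defs where

open import Level using (Level)
open import Algebra.Bundles using (CommutativeRing)
open import Data.Nat as ℕ using (ℕ; zero; suc)
open import Data.Integer as ℤ using (ℤ; +_; ∣_∣; _≤?_)
open import Relation.Nullary using (¬_; yes; no)

-- Everything is parametrised by a commutative ring R together with a
-- function inv, intended to be a multiplicative inverse on nonzero elements.
module Octahedron {c ℓ : Level} (R : CommutativeRing c ℓ)
                  (inv : CommutativeRing.Carrier R → CommutativeRing.Carrier R)
                  (y : ℤ → CommutativeRing.Carrier R) where
  open CommutativeRing R using (Carrier; _+_; _*_; 0#; 1#)

  natCast : ℕ → Carrier
  natCast zero    = 0#
  natCast (suc m) = 1# + natCast m

  prodN : ℕ → (ℕ → Carrier) → Carrier
  prodN zero    z = 1#
  prodN (suc m) z = prodN m z * z m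

  -- ∏_{i=a}^{b} z i with the convention
  --   ∏_{i=a}^{b} z_i = z_a ⋯ z_b                 if b ≥ a ℤ.- 1,
  --   ∏_{i=a}^{b} z_i = ∏_{i=b+1}^{a-1} z_i^{-1}    if b < a ℤ.- 1.
  prodZ : ℤ → ℤ → (ℤ → Carrier) → Carrier
  prodZ a b z with (a ℤ.- + 1) ≤? b
  ... | yes _ = prodN ∣ b ℤ.- a ℤ.+ + 1 ∣ (λ r → z (a ℤ.+ + r))
  ... | no  _ = prodN ∣ a ℤ.- + 1 ℤ.- b ∣ (λ r → inv (z (b ℤ.+ + 1 ℤ.+ + r)))

  m0 : ℤ → ℤ → Carrier
  m0 i j = prodZ (+ 0) (j ℤ.- + 1) (λ l →
             prodZ (+ 0) l (λ m →
               y (+ 3 ℤ.* i ℤ.+ j ℤ.- + 4 ℤ.* l ℤ.+ + 6 ℤ.* m ℤ.- + 1)))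

  -- mm i j t = m_{i,j,t-1}  (the third index k ≥ -1 is shifted by one: t = k+1)
  mm : ℤ → ℤ → ℕ → Carrier
  mm i j zero          = inv (m0 i j)
  mm i j (suc zero)    = m0 i j
  mm i j (suc (suc t)) = mm (i ℤ.- + 1) j (suc t) * mm (i ℤ.+ + 1) j (suc t) * inv (mm i j t)

  -- FF j t = F_{j,t-1}  (t = k+1)
  -- F_{j,k+1} = (F_{j-3,k} F_{j+3,k} + (∏_{i=-k}^{k} y_{j+3i}) F_{j-1,k} F_{j+1,k}) / F_{j,k-1}
  FF : ℤ → ℕ → Carrier
  FF j zero          = 1#
  FF j (suc zero)    = 1#
  FF j (suc (suc t)) =
    (FF (j ℤ.- + 3) (suc t) * FF (j ℤ.+ + 3) (suc t)
      + prodZ (ℤ.- (+ t)) (+ t) (λ i → y (j ℤ.+ + 3 ℤ.* i))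
          * FF (j ℤ.- + 1) (suc t) * FF (j ℤ.+ + 1) (suc t))
    * inv (FF j t)

  -- ff i j t = f_{i,j,t-1} = m_{i,j,t-1} F_{3i+j,t-1}
  ff : ℤ → ℤ → ℕ → Carrier
  ff i j t = mm i j t * FF (+ 3 ℤ.* i ℤ.+ j) t

{-# OPTIONS --safe #-}
-- Since m_{i,j,k+1} m_{i,j,k-1} = m_{i-1,j,k} m_{i+1,j,k}, multiplying the recurrence of F by
-- m_{i,j,k-1} m_{i,j,k+1} turns it into the octahedron recurrence for f = m F, provided
--   m_{i,j-1,k} m_{i,j+1,k} = (∏_{l=-k}^{k} y_{3i+j+3l}) m_{i-1,j,k} m_{i+1,j,k}.
-- Both sides of this relation satisfy X_{i,k+1} X_{i,k-1} = X_{i-1,k} X_{i+1,k} (for the product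
-- of the y's this is a rearrangement of factors), so it suffices to check it at k = 0, where it
-- follows by induction on j from the explicit formula for m_{i,j,0}, and at k = -1, where it is
-- the inverse of the case k = 0.
module Submission where

open import Defs
open import Level using (Level; _⊔_)
open import Algebra.Bundles using (CommutativeRing)
open import Data.Nat as ℕ using (ℕ; zero; suc)
open import Data.Integer as ℤ using (ℤ; +_; -[1+_]; ∣_∣; _≤?_)
import Data.Integer.Properties as ℤP
import Data.Nat.Properties as ℕP
open import Data.Integer.Tactic.RingSolver using (solve-∀)
open import Data.Product using (_×_; _,_; proj₁)
open import Relation.Nullary using (¬_; yes; no; contradiction)
open import Relation.Binary.PropositionalEquality as P using (_≡_)
open import Function.Bundles using (_⇔_; mk⇔; Equivalence)

ℤ-induction : ∀ {p} (Q : ℤ → Set p) → Q (+ 0) → (∀ j → Q j ⇔ Q (j ℤ.+ + 1)) → ∀ j → Q j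
ℤ-induction Q Q₀ step (+ zero)     = Q₀
ℤ-induction Q Q₀ step (+ suc n)    =
  P.subst Q (P.cong +_ (ℕP.+-comm n 1)) (Equivalence.to (step (+ n)) (ℤ-induction Q Q₀ step (+ n)))
ℤ-induction Q Q₀ step -[1+ zero ]  = Equivalence.from (step -[1+ 0 ]) Q₀
ℤ-induction Q Q₀ step -[1+ suc n ] = Equivalence.from (step -[1+ suc n ]) (ℤ-induction Q Q₀ step -[1+ n ])

module _ {c ℓ} (R : CommutativeRing c ℓ) where

  open CommutativeRing R

  InvertsNonzero : (Carrier → Carrier) → Set (c ⊔ ℓ)
  InvertsNonzero inv = ∀ x → ¬ x ≈ 0# → x * inv x ≈ 1#

  Nontrivial : Set ℓ
  Nontrivial = ¬ 1# ≈ 0#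

module Invertibility {c ℓ} (R : CommutativeRing c ℓ) (inv : CommutativeRing.Carrier R → CommutativeRing.Carrier R)
  (inv-inverseʳ : InvertsNonzero R inv) (1≉0 : Nontrivial R) where

  open CommutativeRing R

  open import Relation.Binary.Reasoning.Setoid setoid
  open import Algebra.Solver.CommutativeMonoid *-commutativeMonoid using (solve; _⊜_; _⊕_)

  Invertible : Carrier → Set ℓ
  Invertible x = x * inv x ≈ 1#

  right-inverse⇒invertible : ∀ {x w} → x * w ≈ 1# → Invertible x
  right-inverse⇒invertible {x} {w} xw≈1 = inv-inverseʳ x λ x≈0 → 1≉0 (begin
    1#     ≈⟨ sym xw≈1 ⟩
    x * w  ≈⟨ *-congʳ x≈0 ⟩
    0# * w ≈⟨ zeroˡ w ⟩
    0#     ∎)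

  1-invertible : Invertible 1#
  1-invertible = right-inverse⇒invertible (*-identityˡ 1#)

  inv-invertible : ∀ {x} → Invertible x → Invertible (inv x)
  inv-invertible x⁻¹ = right-inverse⇒invertible (trans (*-comm _ _) x⁻¹)

  inv-unique : ∀ {x w} → Invertible x → x * w ≈ 1# → inv x ≈ w
  inv-unique {x} {w} x⁻¹ xw≈1 = begin
    inv x             ≈⟨ sym (*-identityʳ _) ⟩
    inv x * 1#        ≈⟨ *-congˡ (sym xw≈1) ⟩
    inv x * (x * w)   ≈⟨ sym (*-assoc _ _ _) ⟩
    (inv x * x) * w   ≈⟨ *-congʳ (trans (*-comm _ _) x⁻¹) ⟩
    1# * w            ≈⟨ *-identityˡ w ⟩
    w                 ∎

  inv-cong : ∀ {x z} → Invertible x → x ≈ z → inv x ≈ inv z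
  inv-cong {x} {z} x⁻¹ x≈z = sym (inv-unique (right-inverse⇒invertible zx⁻¹≈1) zx⁻¹≈1)
    where
    zx⁻¹≈1 : z * inv x ≈ 1#
    zx⁻¹≈1 = trans (*-congʳ (sym x≈z)) x⁻¹

  *-inverse : ∀ {x z} → Invertible x → Invertible z → (x * z) * (inv x * inv z) ≈ 1#
  *-inverse {x} {z} x⁻¹ z⁻¹ = begin
    (x * z) * (inv x * inv z) ≈⟨ solve 4 (λ a b c d → (a ⊕ b) ⊕ (c ⊕ d) ⊜ (a ⊕ c) ⊕ (b ⊕ d)) refl x z (inv x) (inv z) ⟩
    (x * inv x) * (z * inv z) ≈⟨ *-cong x⁻¹ z⁻¹ ⟩
    1# * 1#                   ≈⟨ *-identityˡ 1# ⟩
    1#                        ∎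

  *-invertible : ∀ {x z} → Invertible x → Invertible z → Invertible (x * z)
  *-invertible x⁻¹ z⁻¹ = right-inverse⇒invertible (*-inverse x⁻¹ z⁻¹)

  inv-distrib-* : ∀ {x z} → Invertible x → Invertible z → inv (x * z) ≈ inv x * inv z
  inv-distrib-* x⁻¹ z⁻¹ = inv-unique (*-invertible x⁻¹ z⁻¹) (*-inverse x⁻¹ z⁻¹)

  inv-cancelʳ : ∀ {x z} → Invertible z → (x * inv z) * z ≈ x
  inv-cancelʳ {x} {z} z⁻¹ = begin
    (x * inv z) * z ≈⟨ *-assoc _ _ _ ⟩
    x * (inv z * z) ≈⟨ *-congˡ (trans (*-comm _ _) z⁻¹) ⟩
    x * 1#          ≈⟨ *-identityʳ x ⟩
    x               ∎

  *-cancelʳ : ∀ {x w z} → Invertible z → x * z ≈ w * z → x ≈ w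
  *-cancelʳ {x} {w} {z} z⁻¹ xz≈wz = begin
    x               ≈⟨ cancel x ⟨
    (x * z) * inv z ≈⟨ *-congʳ xz≈wz ⟩
    (w * z) * inv z ≈⟨ cancel w ⟩
    w               ∎
    where
    cancel : ∀ v → (v * z) * inv z ≈ v
    cancel v = trans (*-assoc _ _ _) (trans (*-congˡ z⁻¹) (*-identityʳ v))

module Wave {c ℓ} (R : CommutativeRing c ℓ) (inv : CommutativeRing.Carrier R → CommutativeRing.Carrier R)
  (inv-inverseʳ : InvertsNonzero R inv) (1≉0 : Nontrivial R) where

  open CommutativeRing R

  open Invertibility R inv inv-inverseʳ 1≉0
  open import Relation.Binary.Reasoning.Setoid setoid
  open import Algebra.Solver.CommutativeMonoid *-commutativeMonoid using (solve; _⊜_; _⊕_)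

  IsWave : (ℤ → ℕ → Carrier) → Set ℓ
  IsWave X = ∀ i t → X i (suc (suc t)) * X i t ≈ X (i ℤ.- + 1) (suc t) * X (i ℤ.+ + 1) (suc t)

  wave-shift : ∀ d {X} → IsWave X → IsWave (λ i t → X (i ℤ.+ d) t)
  wave-shift d {X} wave i t = begin
    X (i ℤ.+ d) (suc (suc t)) * X (i ℤ.+ d) t
      ≈⟨ wave (i ℤ.+ d) t ⟩
    X (i ℤ.+ d ℤ.- + 1) (suc t) * X (i ℤ.+ d ℤ.+ + 1) (suc t)
      ≡⟨ P.cong₂ (λ u v → X u (suc t) * X v (suc t)) (swap-1 i d) (swap+1 i d) ⟩
    X (i ℤ.- + 1 ℤ.+ d) (suc t) * X (i ℤ.+ + 1 ℤ.+ d) (suc t) ∎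
    where
    swap-1 : ∀ i d → i ℤ.+ d ℤ.- + 1 ≡ i ℤ.- + 1 ℤ.+ d
    swap-1 = solve-∀
    swap+1 : ∀ i d → i ℤ.+ d ℤ.+ + 1 ≡ i ℤ.+ + 1 ℤ.+ d
    swap+1 = solve-∀

  wave-* : ∀ {X Y} → IsWave X → IsWave Y → IsWave (λ i t → X i t * Y i t)
  wave-* {X} {Y} waveX waveY i t = begin
    (X i (suc (suc t)) * Y i (suc (suc t))) * (X i t * Y i t)
      ≈⟨ solve 4 (λ a b c d → (a ⊕ b) ⊕ (c ⊕ d) ⊜ (a ⊕ c) ⊕ (b ⊕ d)) refl _ _ _ _ ⟩
    (X i (suc (suc t)) * X i t) * (Y i (suc (suc t)) * Y i t)
      ≈⟨ *-cong (waveX i t) (waveY i t) ⟩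
    (X (i ℤ.- + 1) (suc t) * X (i ℤ.+ + 1) (suc t)) * (Y (i ℤ.- + 1) (suc t) * Y (i ℤ.+ + 1) (suc t))
      ≈⟨ solve 4 (λ a b c d → (a ⊕ b) ⊕ (c ⊕ d) ⊜ (a ⊕ c) ⊕ (b ⊕ d)) refl _ _ _ _ ⟩
    (X (i ℤ.- + 1) (suc t) * Y (i ℤ.- + 1) (suc t)) * (X (i ℤ.+ + 1) (suc t) * Y (i ℤ.+ + 1) (suc t)) ∎

  wave-unique : ∀ {X Y} → IsWave X → IsWave Y → (∀ i t → Invertible (X i t))
    → (∀ i → X i 0 ≈ Y i 0) → (∀ i → X i 1 ≈ Y i 1) → ∀ i t → X i t ≈ Y i t
  wave-unique {X} {Y} waveX waveY X⁻¹ X≈Y₀ X≈Y₁ i t = proj₁ (agree t) i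
    where
    agree : ∀ t → (∀ i → X i t ≈ Y i t) × (∀ i → X i (suc t) ≈ Y i (suc t))
    agree zero    = X≈Y₀ , X≈Y₁
    agree (suc t) with agree t
    ... | X≈Yₜ , X≈Yₜ₊₁ = X≈Yₜ₊₁ , λ i → *-cancelʳ (X⁻¹ i t) (begin
      X i (suc (suc t)) * X i t                               ≈⟨ waveX i t ⟩
      X (i ℤ.- + 1) (suc t) * X (i ℤ.+ + 1) (suc t)           ≈⟨ *-cong (X≈Yₜ₊₁ _) (X≈Yₜ₊₁ _) ⟩
      Y (i ℤ.- + 1) (suc t) * Y (i ℤ.+ + 1) (suc t)           ≈⟨ waveY i t ⟨
      Y i (suc (suc t)) * Y i t                               ≈⟨ *-congˡ (X≈Yₜ i) ⟨
      Y i (suc (suc t)) * X i t                               ∎)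

module OctahedronSolution {c ℓ} (R : CommutativeRing c ℓ) where

  open CommutativeRing R

  module _ (inv : Carrier → Carrier) (inv-inverseʳ : InvertsNonzero R inv)
           (y : ℤ → Carrier) (y≉0 : ∀ j → ¬ y j ≈ 0#) where

    open Octahedron R inv y
    open import Relation.Binary.Reasoning.Setoid setoid
    open import Algebra.Solver.CommutativeMonoid *-commutativeMonoid using (solve; _⊜_; _⊕_)

    1≉0 : Nontrivial R
    1≉0 1≈0 = y≉0 (+ 0) (begin
      y (+ 0)      ≈⟨ *-identityʳ _ ⟨
      y (+ 0) * 1# ≈⟨ *-congˡ 1≈0 ⟩
      y (+ 0) * 0# ≈⟨ zeroʳ _ ⟩
      0#           ∎)

    open Invertibility R inv inv-inverseʳ 1≉0
    open Wave R inv inv-inverseʳ 1≉0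

    y-invertible : ∀ j → Invertible (y j)
    y-invertible j = inv-inverseʳ (y j) (y≉0 j)

    prodN-invertible : ∀ n {z} → (∀ r → Invertible (z r)) → Invertible (prodN n z)
    prodN-invertible zero    z⁻¹ = 1-invertible
    prodN-invertible (suc n) z⁻¹ = *-invertible (prodN-invertible n z⁻¹) (z⁻¹ n)

    prodN-cong : ∀ n {z w} → (∀ r → z r ≡ w r) → prodN n z ≡ prodN n w
    prodN-cong zero    z≡w = P.refl
    prodN-cong (suc n) z≡w = P.cong₂ _*_ (prodN-cong n z≡w) (z≡w n)

    prodN-uncons : ∀ n z → prodN (suc n) z ≈ z 0 * prodN n (λ r → z (suc r))
    prodN-uncons zero    z = trans (*-identityˡ _) (sym (*-identityʳ _))
    prodN-uncons (suc n) z = trans (*-congʳ (prodN-uncons n z)) (*-assoc _ _ _)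

    prodZ-invertible : ∀ a b {z} → (∀ k → Invertible (z k)) → Invertible (prodZ a b z)
    prodZ-invertible a b z⁻¹ with (a ℤ.- + 1) ≤? b
    ... | yes _ = prodN-invertible ∣ b ℤ.- a ℤ.+ + 1 ∣ (λ r → z⁻¹ _)
    ... | no  _ = prodN-invertible ∣ a ℤ.- + 1 ℤ.- b ∣ (λ r → inv-invertible (z⁻¹ _))

    prodZ-cong : ∀ a b {z w} → (∀ k → z k ≡ w k) → prodZ a b z ≡ prodZ a b w
    prodZ-cong a b z≡w with (a ℤ.- + 1) ≤? b
    ... | yes _ = prodN-cong ∣ b ℤ.- a ℤ.+ + 1 ∣ (λ r → z≡w _)
    ... | no  _ = prodN-cong ∣ a ℤ.- + 1 ℤ.- b ∣ (λ r → P.cong inv (z≡w _))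

    prodZ-ascending : ∀ a b z n → b ℤ.- a ℤ.+ + 1 ≡ + n → prodZ a b z ≡ prodN n (λ r → z (a ℤ.+ + r))
    prodZ-ascending a b z n length≡n with (a ℤ.- + 1) ≤? b
    ... | yes _ rewrite length≡n = P.refl
    ... | no a-1≰b = contradiction (P.subst (λ x → a ℤ.- + 1 ℤ.≤ x) b≡a-1+n (ℤP.i≤i+j (a ℤ.- + 1) (+ n))) a-1≰b
      where
      b≡a-1+n : a ℤ.- + 1 ℤ.+ + n ≡ b
      b≡a-1+n = P.trans (P.cong (λ x → a ℤ.- + 1 ℤ.+ x) (P.sym length≡n)) (lemma a b)
        where lemma : ∀ a b → a ℤ.- + 1 ℤ.+ (b ℤ.- a ℤ.+ + 1) ≡ b
              lemma = solve-∀

    length≡-gap : ∀ a b → b ℤ.- a ℤ.+ + 1 ≡ ℤ.- (a ℤ.- + 1 ℤ.- b)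
    length≡-gap = solve-∀

    prodZ-descending : ∀ a b z m → a ℤ.- + 1 ℤ.- b ≡ + m
      → prodZ a b z ≡ prodN m (λ r → inv (z (b ℤ.+ + 1 ℤ.+ + r)))
    prodZ-descending a b z m gap≡m with (a ℤ.- + 1) ≤? b
    ... | no _ rewrite gap≡m = P.refl
    ... | yes a-1≤b with P.subst (ℤ._≤ + 0) gap≡m (ℤP.i≤j⇒i-j≤0 a-1≤b)
    ...   | ℤ.+≤+ ℕ.z≤n rewrite P.trans (length≡-gap a b) (P.cong ℤ.-_ gap≡m) = P.refl

    prodZ-snoc : ∀ a b z → (∀ k → Invertible (z k)) → prodZ a (b ℤ.+ + 1) z ≈ prodZ a b z * z (b ℤ.+ + 1)
    prodZ-snoc a b z z⁻¹ with b ℤ.- a ℤ.+ + 1 in length≡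
    ... | + n = begin
      prodZ a (b ℤ.+ + 1) z
        ≡⟨ prodZ-ascending a (b ℤ.+ + 1) z (suc n) (P.trans (longer a b) (P.cong (λ x → + 1 ℤ.+ x) length≡)) ⟩
      prodN n (λ r → z (a ℤ.+ + r)) * z (a ℤ.+ + n)
        ≡⟨ P.cong₂ _*_ (P.sym (prodZ-ascending a b z n length≡)) (P.cong z (P.trans (P.cong (λ x → a ℤ.+ x) (P.sym length≡)) (last a b))) ⟩
      prodZ a b z * z (b ℤ.+ + 1) ∎
      where
      longer : ∀ a b → b ℤ.+ + 1 ℤ.- a ℤ.+ + 1 ≡ + 1 ℤ.+ (b ℤ.- a ℤ.+ + 1)
      longer = solve-∀
      last : ∀ a b → a ℤ.+ (b ℤ.- a ℤ.+ + 1) ≡ b ℤ.+ + 1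
      last = solve-∀
    ... | -[1+ m ] = begin
      prodZ a (b ℤ.+ + 1) z
        ≡⟨ prodZ-descending a (b ℤ.+ + 1) z m (P.trans (shorter a b) (P.cong (λ x → ℤ.- x ℤ.- + 1) length≡)) ⟩
      prodN m (λ r → inv (z (b ℤ.+ + 1 ℤ.+ + 1 ℤ.+ + r)))
        ≡⟨ prodN-cong m (λ r → P.cong (λ k → inv (z k)) (reassoc b (+ r))) ⟩
      prodN m (λ r → g (suc r))
        ≈⟨ *-identityˡ _ ⟨
      1# * prodN m (λ r → g (suc r))
        ≈⟨ *-congʳ (trans (*-comm _ _) (z⁻¹ (b ℤ.+ + 1))) ⟨
      (inv (z (b ℤ.+ + 1)) * z (b ℤ.+ + 1)) * prodN m (λ r → g (suc r))
        ≈⟨ solve 3 (λ a b c → (a ⊕ b) ⊕ c ⊜ (a ⊕ c) ⊕ b) refl _ _ _ ⟩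
      (inv (z (b ℤ.+ + 1)) * prodN m (λ r → g (suc r))) * z (b ℤ.+ + 1)
        ≡⟨ P.cong (λ k → (inv (z k) * prodN m (λ r → g (suc r))) * z (b ℤ.+ + 1)) (P.sym (ℤP.+-identityʳ _)) ⟩
      (g 0 * prodN m (λ r → g (suc r))) * z (b ℤ.+ + 1)
        ≈⟨ *-congʳ (prodN-uncons m g) ⟨
      prodN (suc m) g * z (b ℤ.+ + 1)
        ≡⟨ P.cong (_* z (b ℤ.+ + 1)) (prodZ-descending a b z (suc m) (P.trans (gap≡-length a b) (P.cong ℤ.-_ length≡))) ⟨
      prodZ a b z * z (b ℤ.+ + 1) ∎
      where
      g : ℕ → Carrier
      g r = inv (z (b ℤ.+ + 1 ℤ.+ + r))
      shorter : ∀ a b → a ℤ.- + 1 ℤ.- (b ℤ.+ + 1) ≡ ℤ.- (b ℤ.- a ℤ.+ + 1) ℤ.- + 1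
      shorter = solve-∀
      reassoc : ∀ b x → b ℤ.+ + 1 ℤ.+ + 1 ℤ.+ x ≡ b ℤ.+ + 1 ℤ.+ (+ 1 ℤ.+ x)
      reassoc = solve-∀
      gap≡-length : ∀ a b → a ℤ.- + 1 ℤ.- b ≡ ℤ.- (b ℤ.- a ℤ.+ + 1)
      gap≡-length = solve-∀

    -- m0 i j is definitionally m₀ (3i+j) j: the paper's m_{i,j,0} depends on i only through 3i+j.
    m₀-factor : ℤ → ℤ → Carrier
    m₀-factor a l = prodZ (+ 0) l (λ m → y (a ℤ.- + 4 ℤ.* l ℤ.+ + 6 ℤ.* m ℤ.- + 1))

    m₀ : ℤ → ℤ → Carrier
    m₀ a j = prodZ (+ 0) (j ℤ.- + 1) (m₀-factor a)

    m₀-factor-invertible : ∀ a l → Invertible (m₀-factor a l)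
    m₀-factor-invertible a l = prodZ-invertible (+ 0) l (λ _ → y-invertible _)

    m₀-invertible : ∀ a j → Invertible (m₀ a j)
    m₀-invertible a j = prodZ-invertible (+ 0) (j ℤ.- + 1) (m₀-factor-invertible a)

    m₀-snoc : ∀ a j → m₀ a (j ℤ.+ + 1) ≈ m₀ a j * m₀-factor a j
    m₀-snoc a j = begin
      prodZ (+ 0) (j ℤ.+ + 1 ℤ.- + 1) (m₀-factor a)
        ≡⟨ P.cong (λ k → prodZ (+ 0) k (m₀-factor a)) (pred-succ j) ⟩
      prodZ (+ 0) (j ℤ.- + 1 ℤ.+ + 1) (m₀-factor a)
        ≈⟨ prodZ-snoc (+ 0) (j ℤ.- + 1) (m₀-factor a) (m₀-factor-invertible a) ⟩
      m₀ a j * m₀-factor a (j ℤ.- + 1 ℤ.+ + 1)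
        ≡⟨ P.cong (λ k → m₀ a j * m₀-factor a k) (succ-pred j) ⟩
      m₀ a j * m₀-factor a j ∎
      where
      pred-succ : ∀ j → j ℤ.+ + 1 ℤ.- + 1 ≡ j ℤ.- + 1 ℤ.+ + 1
      pred-succ = solve-∀
      succ-pred : ∀ j → j ℤ.- + 1 ℤ.+ + 1 ≡ j
      succ-pred = solve-∀

    m₀-factor-snoc : ∀ b l → m₀-factor (b ℤ.+ + 4) (l ℤ.+ + 1) ≈ m₀-factor b l * y (b ℤ.+ + 2 ℤ.* l ℤ.+ + 5)
    m₀-factor-snoc b l = begin
      m₀-factor (b ℤ.+ + 4) (l ℤ.+ + 1)
        ≡⟨ prodZ-cong (+ 0) (l ℤ.+ + 1) (λ m → P.cong y (shift b l m)) ⟩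
      prodZ (+ 0) (l ℤ.+ + 1) term
        ≈⟨ prodZ-snoc (+ 0) l term (λ _ → y-invertible _) ⟩
      m₀-factor b l * term (l ℤ.+ + 1)
        ≡⟨ P.cong (λ k → m₀-factor b l * y k) (last b l) ⟩
      m₀-factor b l * y (b ℤ.+ + 2 ℤ.* l ℤ.+ + 5) ∎
      where
      term : ℤ → Carrier
      term m = y (b ℤ.- + 4 ℤ.* l ℤ.+ + 6 ℤ.* m ℤ.- + 1)
      shift : ∀ b l m → b ℤ.+ + 4 ℤ.- + 4 ℤ.* (l ℤ.+ + 1) ℤ.+ + 6 ℤ.* m ℤ.- + 1 ≡ b ℤ.- + 4 ℤ.* l ℤ.+ + 6 ℤ.* m ℤ.- + 1
      shift = solve-∀
      last : ∀ b l → b ℤ.- + 4 ℤ.* l ℤ.+ + 6 ℤ.* (l ℤ.+ + 1) ℤ.- + 1 ≡ b ℤ.+ + 2 ℤ.* l ℤ.+ + 5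
      last = solve-∀

    m₀-factor-shift₁ : ∀ a j → m₀-factor (a ℤ.+ + 1) (j ℤ.+ + 1) ≈ m₀-factor (a ℤ.- + 3) j * y (a ℤ.+ + 2 ℤ.* j ℤ.+ + 2)
    m₀-factor-shift₁ a j = begin
      m₀-factor (a ℤ.+ + 1) (j ℤ.+ + 1)         ≡⟨ P.cong (λ b → m₀-factor b (j ℤ.+ + 1)) (e₁ a) ⟩
      m₀-factor (a ℤ.- + 3 ℤ.+ + 4) (j ℤ.+ + 1) ≈⟨ m₀-factor-snoc (a ℤ.- + 3) j ⟩
      m₀-factor (a ℤ.- + 3) j * y (a ℤ.- + 3 ℤ.+ + 2 ℤ.* j ℤ.+ + 5)
        ≡⟨ P.cong (λ k → m₀-factor (a ℤ.- + 3) j * y k) (e₂ a j) ⟩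
      m₀-factor (a ℤ.- + 3) j * y (a ℤ.+ + 2 ℤ.* j ℤ.+ + 2) ∎
      where
      e₁ : ∀ a → a ℤ.+ + 1 ≡ a ℤ.- + 3 ℤ.+ + 4
      e₁ = solve-∀
      e₂ : ∀ a j → a ℤ.- + 3 ℤ.+ + 2 ℤ.* j ℤ.+ + 5 ≡ a ℤ.+ + 2 ℤ.* j ℤ.+ + 2
      e₂ = solve-∀

    m₀-factor-shift₂ : ∀ a j → m₀-factor (a ℤ.+ + 3) j ≈ m₀-factor (a ℤ.- + 1) (j ℤ.- + 1) * y (a ℤ.+ + 2 ℤ.* j ℤ.+ + 2)
    m₀-factor-shift₂ a j = begin
      m₀-factor (a ℤ.+ + 3) j ≡⟨ P.cong₂ m₀-factor (e₁ a) (e₂ j) ⟩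
      m₀-factor (a ℤ.- + 1 ℤ.+ + 4) (j ℤ.- + 1 ℤ.+ + 1) ≈⟨ m₀-factor-snoc (a ℤ.- + 1) (j ℤ.- + 1) ⟩
      m₀-factor (a ℤ.- + 1) (j ℤ.- + 1) * y (a ℤ.- + 1 ℤ.+ + 2 ℤ.* (j ℤ.- + 1) ℤ.+ + 5)
        ≡⟨ P.cong (λ k → m₀-factor (a ℤ.- + 1) (j ℤ.- + 1) * y k) (e₃ a j) ⟩
      m₀-factor (a ℤ.- + 1) (j ℤ.- + 1) * y (a ℤ.+ + 2 ℤ.* j ℤ.+ + 2) ∎
      where
      e₁ : ∀ a → a ℤ.+ + 3 ≡ a ℤ.- + 1 ℤ.+ + 4
      e₁ = solve-∀
      e₂ : ∀ j → j ≡ j ℤ.- + 1 ℤ.+ + 1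
      e₂ = solve-∀
      e₃ : ∀ a j → a ℤ.- + 1 ℤ.+ + 2 ℤ.* (j ℤ.- + 1) ℤ.+ + 5 ≡ a ℤ.+ + 2 ℤ.* j ℤ.+ + 2
      e₃ = solve-∀

    M₀Relation : ℤ → ℤ → Set ℓ
    M₀Relation a j =
      m₀ (a ℤ.- + 1) (j ℤ.- + 1) * m₀ (a ℤ.+ + 1) (j ℤ.+ + 1) ≈ y a * (m₀ (a ℤ.- + 3) j * m₀ (a ℤ.+ + 3) j)

    m₀-relation-base : ∀ a → M₀Relation a (+ 0)
    m₀-relation-base a = begin
      m₀ (a ℤ.- + 1) -[1+ 0 ] * m₀ (a ℤ.+ + 1) (+ 1)
        ≈⟨ *-cong (trans (*-identityˡ _) (inv-unique 1-invertible (*-identityˡ 1#))) (*-identityˡ _) ⟩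
      1# * (1# * y (a ℤ.+ + 1 ℤ.- + 4 ℤ.* + 0 ℤ.+ + 6 ℤ.* + 0 ℤ.- + 1))
        ≈⟨ trans (*-identityˡ _) (*-identityˡ _) ⟩
      y (a ℤ.+ + 1 ℤ.- + 4 ℤ.* + 0 ℤ.+ + 6 ℤ.* + 0 ℤ.- + 1)
        ≡⟨ P.cong y (index a) ⟩
      y a
        ≈⟨ trans (*-congˡ (*-identityˡ 1#)) (*-identityʳ _) ⟨
      y a * (1# * 1#) ∎
      where
      index : ∀ a → a ℤ.+ + 1 ℤ.- + 4 ℤ.* + 0 ℤ.+ + 6 ℤ.* + 0 ℤ.- + 1 ≡ a
      index = solve-∀

    -- Raising j by one multiplies both sides of the relation by the same invertible K.
    m₀-relation-step : ∀ a j → M₀Relation a j ⇔ M₀Relation a (j ℤ.+ + 1)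
    m₀-relation-step a j = mk⇔
      (λ rel → trans lhs-step (trans (*-congʳ rel) (sym rhs-step)))
      (λ rel → *-cancelʳ K-invertible (trans (sym lhs-step) (trans rel rhs-step)))
      where
      Y : Carrier
      Y = y (a ℤ.+ + 2 ℤ.* j ℤ.+ + 2)
      K : Carrier
      K = m₀-factor (a ℤ.- + 1) (j ℤ.- + 1) * (m₀-factor (a ℤ.- + 3) j * Y)
      K-invertible : Invertible K
      K-invertible = *-invertible (m₀-factor-invertible (a ℤ.- + 1) (j ℤ.- + 1))
                                   (*-invertible (m₀-factor-invertible (a ℤ.- + 3) j) (y-invertible _))

      lhs-step : m₀ (a ℤ.- + 1) (j ℤ.+ + 1 ℤ.- + 1) * m₀ (a ℤ.+ + 1) (j ℤ.+ + 1 ℤ.+ + 1)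
               ≈ (m₀ (a ℤ.- + 1) (j ℤ.- + 1) * m₀ (a ℤ.+ + 1) (j ℤ.+ + 1)) * K
      lhs-step = begin
        m₀ (a ℤ.- + 1) (j ℤ.+ + 1 ℤ.- + 1) * m₀ (a ℤ.+ + 1) (j ℤ.+ + 1 ℤ.+ + 1)
          ≡⟨ P.cong (λ k → m₀ (a ℤ.- + 1) k * m₀ (a ℤ.+ + 1) (j ℤ.+ + 1 ℤ.+ + 1)) (e j) ⟩
        m₀ (a ℤ.- + 1) (j ℤ.- + 1 ℤ.+ + 1) * m₀ (a ℤ.+ + 1) (j ℤ.+ + 1 ℤ.+ + 1)
          ≈⟨ *-cong (m₀-snoc (a ℤ.- + 1) (j ℤ.- + 1)) (trans (m₀-snoc (a ℤ.+ + 1) (j ℤ.+ + 1)) (*-congˡ (m₀-factor-shift₁ a j))) ⟩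
        (m₀ (a ℤ.- + 1) (j ℤ.- + 1) * m₀-factor (a ℤ.- + 1) (j ℤ.- + 1))
          * (m₀ (a ℤ.+ + 1) (j ℤ.+ + 1) * (m₀-factor (a ℤ.- + 3) j * Y))
          ≈⟨ solve 4 (λ a b c d → (a ⊕ b) ⊕ (c ⊕ d) ⊜ (a ⊕ c) ⊕ (b ⊕ d)) refl _ _ _ _ ⟩
        (m₀ (a ℤ.- + 1) (j ℤ.- + 1) * m₀ (a ℤ.+ + 1) (j ℤ.+ + 1)) * K ∎
        where
        e : ∀ j → j ℤ.+ + 1 ℤ.- + 1 ≡ j ℤ.- + 1 ℤ.+ + 1
        e = solve-∀

      rhs-step : y a * (m₀ (a ℤ.- + 3) (j ℤ.+ + 1) * m₀ (a ℤ.+ + 3) (j ℤ.+ + 1))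
               ≈ (y a * (m₀ (a ℤ.- + 3) j * m₀ (a ℤ.+ + 3) j)) * K
      rhs-step = begin
        y a * (m₀ (a ℤ.- + 3) (j ℤ.+ + 1) * m₀ (a ℤ.+ + 3) (j ℤ.+ + 1))
          ≈⟨ *-congˡ (*-cong (m₀-snoc (a ℤ.- + 3) j) (trans (m₀-snoc (a ℤ.+ + 3) j) (*-congˡ (m₀-factor-shift₂ a j)))) ⟩
        y a * ((m₀ (a ℤ.- + 3) j * m₀-factor (a ℤ.- + 3) j)
                * (m₀ (a ℤ.+ + 3) j * (m₀-factor (a ℤ.- + 1) (j ℤ.- + 1) * Y)))
          ≈⟨ solve 6 (λ y a b c d e → y ⊕ ((a ⊕ b) ⊕ (c ⊕ (d ⊕ e))) ⊜ (y ⊕ (a ⊕ c)) ⊕ (d ⊕ (b ⊕ e))) refl _ _ _ _ _ _ ⟩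
        (y a * (m₀ (a ℤ.- + 3) j * m₀ (a ℤ.+ + 3) j)) * K ∎

    m₀-relation : ∀ a j → M₀Relation a j
    m₀-relation a = ℤ-induction (M₀Relation a) (m₀-relation-base a) (m₀-relation-step a)

    -- coeff J (k+1) = ∏_{i=-k}^{k} y_{J+3i} is the coefficient in the recurrence of FF;
    -- coeff J 0 = y_J⁻¹ is the value of that product at k = -1 under the product convention.
    coeff : ℤ → ℕ → Carrier
    coeff J zero    = inv (y J)
    coeff J (suc k) = prodZ (ℤ.- (+ k)) (+ k) (λ i → y (J ℤ.+ + 3 ℤ.* i))

    coeff-invertible : ∀ J t → Invertible (coeff J t)
    coeff-invertible J zero    = inv-invertible (y-invertible J)
    coeff-invertible J (suc k) = prodZ-invertible (ℤ.- (+ k)) (+ k) (λ _ → y-invertible _)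

    coeff-one : ∀ J → coeff J 1 ≈ y J
    coeff-one J = trans (*-identityˡ _) (reflexive (P.cong y (ℤP.+-identityʳ J)))

    y-progression : ℤ → ℕ → Carrier
    y-progression c n = prodN n (λ r → y (c ℤ.+ + 3 ℤ.* + r))

    coeff-progression : ∀ J k → coeff J (suc k) ≡ y-progression (J ℤ.- + 3 ℤ.* + k) (suc (k ℕ.+ k))
    coeff-progression J k = P.trans
      (prodZ-ascending (ℤ.- (+ k)) (+ k) (λ i → y (J ℤ.+ + 3 ℤ.* i)) (suc (k ℕ.+ k)) (length (+ k)))
      (prodN-cong (suc (k ℕ.+ k)) (λ r → P.cong y (index J (+ k) (+ r))))
      where
      length : ∀ x → x ℤ.- ℤ.- x ℤ.+ + 1 ≡ + 1 ℤ.+ (x ℤ.+ x)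
      length = solve-∀
      index : ∀ J x r → J ℤ.+ + 3 ℤ.* (ℤ.- x ℤ.+ r) ≡ J ℤ.- + 3 ℤ.* x ℤ.+ + 3 ℤ.* r
      index = solve-∀

    progression-exchange : ∀ c n → y-progression c (4 ℕ.+ n) * y-progression (c ℤ.+ + 6) n
                                  ≈ y-progression c (2 ℕ.+ n) * y-progression (c ℤ.+ + 6) (2 ℕ.+ n)
    progression-exchange c n = begin
      ((y-progression c (2 ℕ.+ n) * y (c ℤ.+ + 3 ℤ.* (+ 2 ℤ.+ + n))) * y (c ℤ.+ + 3 ℤ.* (+ 3 ℤ.+ + n)))
        * y-progression (c ℤ.+ + 6) n
        ≡⟨ P.cong₂ (λ u v → ((y-progression c (2 ℕ.+ n) * y u) * y v) * y-progression (c ℤ.+ + 6) n)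
                   (e₁ c (+ n)) (e₂ c (+ n)) ⟩
      ((y-progression c (2 ℕ.+ n) * y (c ℤ.+ + 6 ℤ.+ + 3 ℤ.* + n)) * y (c ℤ.+ + 6 ℤ.+ + 3 ℤ.* (+ 1 ℤ.+ + n)))
        * y-progression (c ℤ.+ + 6) n
        ≈⟨ solve 4 (λ a b c d → ((a ⊕ b) ⊕ c) ⊕ d ⊜ a ⊕ ((d ⊕ b) ⊕ c)) refl _ _ _ _ ⟩
      y-progression c (2 ℕ.+ n) * y-progression (c ℤ.+ + 6) (2 ℕ.+ n) ∎
      where
      e₁ : ∀ c x → c ℤ.+ + 3 ℤ.* (+ 2 ℤ.+ x) ≡ c ℤ.+ + 6 ℤ.+ + 3 ℤ.* x
      e₁ = solve-∀
      e₂ : ∀ c x → c ℤ.+ + 3 ℤ.* (+ 3 ℤ.+ x) ≡ c ℤ.+ + 6 ℤ.+ + 3 ℤ.* (+ 1 ℤ.+ x)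
      e₂ = solve-∀

    coeff-recurrence : ∀ J t → coeff J (suc (suc t)) * coeff J t
                             ≈ coeff (J ℤ.- + 3) (suc t) * coeff (J ℤ.+ + 3) (suc t)
    coeff-recurrence J zero = begin
      coeff J 2 * inv (y J)
        ≡⟨ P.cong (_* inv (y J)) (coeff-progression J 1) ⟩
      (((1# * y (s ℤ.+ + 0)) * y (s ℤ.+ + 3)) * y (s ℤ.+ + 6)) * inv (y J)
        ≡⟨ P.cong₂ (λ u v → (((1# * y u) * y v) * y (s ℤ.+ + 6)) * inv (y J)) (ℤP.+-identityʳ s) (e₁ J) ⟩
      (((1# * y s) * y J) * y (s ℤ.+ + 6)) * inv (y J)
        ≈⟨ solve 4 (λ a b s d → ((a ⊕ b) ⊕ s) ⊕ d ⊜ (a ⊕ s) ⊕ (b ⊕ d)) refl _ _ _ _ ⟩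
      ((1# * y s) * y (s ℤ.+ + 6)) * (y J * inv (y J))
        ≈⟨ trans (*-congˡ (y-invertible J)) (*-identityʳ _) ⟩
      (1# * y s) * y (s ℤ.+ + 6)
        ≈⟨ *-cong (trans (*-identityˡ _) (sym (coeff-one s))) (reflexive (P.cong y (e₂ J))) ⟩
      coeff s 1 * y (J ℤ.+ + 3)
        ≈⟨ *-congˡ (coeff-one (J ℤ.+ + 3)) ⟨
      coeff s 1 * coeff (J ℤ.+ + 3) 1 ∎
      where
      s : ℤ
      s = J ℤ.- + 3
      e₁ : ∀ J → J ℤ.- + 3 ℤ.+ + 3 ≡ J
      e₁ = solve-∀
      e₂ : ∀ J → J ℤ.- + 3 ℤ.+ + 6 ≡ J ℤ.+ + 3
      e₂ = solve-∀
    coeff-recurrence J (suc k) = begin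
      coeff J (3 ℕ.+ k) * coeff J (1 ℕ.+ k)
        ≡⟨ P.cong₂ _*_ (P.trans (coeff-progression J (2 ℕ.+ k)) (P.cong (y-progression s) (P.cong (2 ℕ.+_) double+2)))
                       (P.trans (coeff-progression J k) (P.cong (λ x → y-progression x n) (e₁ J (+ k)))) ⟩
      y-progression s (4 ℕ.+ n) * y-progression (s ℤ.+ + 6) n
        ≈⟨ progression-exchange s n ⟩
      y-progression s (2 ℕ.+ n) * y-progression (s ℤ.+ + 6) (2 ℕ.+ n)
        ≡⟨ P.cong₂ _*_ (P.trans (coeff-progression (J ℤ.- + 3) (1 ℕ.+ k)) (P.cong₂ y-progression (e₂ J (+ k)) double+1))
                       (P.trans (coeff-progression (J ℤ.+ + 3) (1 ℕ.+ k)) (P.cong₂ y-progression (e₃ J (+ k)) double+1)) ⟨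
      coeff (J ℤ.- + 3) (2 ℕ.+ k) * coeff (J ℤ.+ + 3) (2 ℕ.+ k) ∎
      where
      s : ℤ
      s = J ℤ.- + 3 ℤ.* (+ 2 ℤ.+ + k)
      n : ℕ
      n = suc (k ℕ.+ k)
      double+1 : suc (suc k ℕ.+ suc k) ≡ 2 ℕ.+ n
      double+1 = P.cong (2 ℕ.+_) (ℕP.+-suc k k)
      double+2 : suc (k ℕ.+ suc (suc k)) ≡ 2 ℕ.+ n
      double+2 = P.cong suc (P.trans (ℕP.+-suc k (suc k)) (P.cong suc (ℕP.+-suc k k)))
      e₁ : ∀ J x → J ℤ.- + 3 ℤ.* x ≡ J ℤ.- + 3 ℤ.* (+ 2 ℤ.+ x) ℤ.+ + 6
      e₁ = solve-∀
      e₂ : ∀ J x → J ℤ.- + 3 ℤ.- + 3 ℤ.* (+ 1 ℤ.+ x) ≡ J ℤ.- + 3 ℤ.* (+ 2 ℤ.+ x)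
      e₂ = solve-∀
      e₃ : ∀ J x → J ℤ.+ + 3 ℤ.- + 3 ℤ.* (+ 1 ℤ.+ x) ≡ J ℤ.- + 3 ℤ.* (+ 2 ℤ.+ x) ℤ.+ + 6
      e₃ = solve-∀

    3[i-1]+j≡3i+j-3 : ∀ i j → + 3 ℤ.* (i ℤ.- + 1) ℤ.+ j ≡ + 3 ℤ.* i ℤ.+ j ℤ.- + 3
    3[i-1]+j≡3i+j-3 = solve-∀

    3[i+1]+j≡3i+j+3 : ∀ i j → + 3 ℤ.* (i ℤ.+ + 1) ℤ.+ j ≡ + 3 ℤ.* i ℤ.+ j ℤ.+ + 3
    3[i+1]+j≡3i+j+3 = solve-∀

    3i+[j-1]≡3i+j-1 : ∀ i j → + 3 ℤ.* i ℤ.+ (j ℤ.- + 1) ≡ + 3 ℤ.* i ℤ.+ j ℤ.- + 1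
    3i+[j-1]≡3i+j-1 = solve-∀

    3i+[j+1]≡3i+j+1 : ∀ i j → + 3 ℤ.* i ℤ.+ (j ℤ.+ + 1) ≡ + 3 ℤ.* i ℤ.+ j ℤ.+ + 1
    3i+[j+1]≡3i+j+1 = solve-∀

    mm-invertible : ∀ t i j → Invertible (mm i j t)
    mm-invertible zero          i j = inv-invertible (m₀-invertible (+ 3 ℤ.* i ℤ.+ j) j)
    mm-invertible (suc zero)    i j = m₀-invertible (+ 3 ℤ.* i ℤ.+ j) j
    mm-invertible (suc (suc t)) i j = *-invertible
      (*-invertible (mm-invertible (suc t) (i ℤ.- + 1) j) (mm-invertible (suc t) (i ℤ.+ + 1) j))
      (inv-invertible (mm-invertible t i j))

    mm-wave : ∀ j → IsWave (λ i t → mm i j t)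
    mm-wave j i t = inv-cancelʳ (mm-invertible t i j)

    coeff-wave : ∀ j → IsWave (λ i t → coeff (+ 3 ℤ.* i ℤ.+ j) t)
    coeff-wave j i t = begin
      coeff a (suc (suc t)) * coeff a t                         ≈⟨ coeff-recurrence a t ⟩
      coeff (a ℤ.- + 3) (suc t) * coeff (a ℤ.+ + 3) (suc t)
        ≡⟨ P.cong₂ (λ u v → coeff u (suc t) * coeff v (suc t)) (3[i-1]+j≡3i+j-3 i j) (3[i+1]+j≡3i+j+3 i j) ⟨
      coeff (+ 3 ℤ.* (i ℤ.- + 1) ℤ.+ j) (suc t) * coeff (+ 3 ℤ.* (i ℤ.+ + 1) ℤ.+ j) (suc t) ∎
      where
      a : ℤ
      a = + 3 ℤ.* i ℤ.+ j

    mm-relation : ∀ j i t → mm i (j ℤ.- + 1) t * mm i (j ℤ.+ + 1) t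
                          ≈ coeff (+ 3 ℤ.* i ℤ.+ j) t * (mm (i ℤ.- + 1) j t * mm (i ℤ.+ + 1) j t)
    mm-relation j = wave-unique
      (wave-* (mm-wave (j ℤ.- + 1)) (mm-wave (j ℤ.+ + 1)))
      (wave-* (coeff-wave j) (wave-* (wave-shift (ℤ.- + 1) (mm-wave j)) (wave-shift (+ 1) (mm-wave j))))
      (λ i t → *-invertible (mm-invertible t i (j ℤ.- + 1)) (mm-invertible t i (j ℤ.+ + 1)))
      relation₀ relation₁
      where
      relation₁ : ∀ i → mm i (j ℤ.- + 1) 1 * mm i (j ℤ.+ + 1) 1
                      ≈ coeff (+ 3 ℤ.* i ℤ.+ j) 1 * (mm (i ℤ.- + 1) j 1 * mm (i ℤ.+ + 1) j 1)
      relation₁ i = begin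
        m₀ (+ 3 ℤ.* i ℤ.+ (j ℤ.- + 1)) (j ℤ.- + 1) * m₀ (+ 3 ℤ.* i ℤ.+ (j ℤ.+ + 1)) (j ℤ.+ + 1)
          ≡⟨ P.cong₂ (λ u v → m₀ u (j ℤ.- + 1) * m₀ v (j ℤ.+ + 1)) (3i+[j-1]≡3i+j-1 i j) (3i+[j+1]≡3i+j+1 i j) ⟩
        m₀ (a ℤ.- + 1) (j ℤ.- + 1) * m₀ (a ℤ.+ + 1) (j ℤ.+ + 1)
          ≈⟨ m₀-relation a j ⟩
        y a * (m₀ (a ℤ.- + 3) j * m₀ (a ℤ.+ + 3) j)
          ≡⟨ P.cong₂ (λ u v → y a * (m₀ u j * m₀ v j)) (3[i-1]+j≡3i+j-3 i j) (3[i+1]+j≡3i+j+3 i j) ⟨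
        y a * (m₀ (+ 3 ℤ.* (i ℤ.- + 1) ℤ.+ j) j * m₀ (+ 3 ℤ.* (i ℤ.+ + 1) ℤ.+ j) j)
          ≈⟨ *-congʳ (coeff-one a) ⟨
        coeff a 1 * (m₀ (+ 3 ℤ.* (i ℤ.- + 1) ℤ.+ j) j * m₀ (+ 3 ℤ.* (i ℤ.+ + 1) ℤ.+ j) j) ∎
        where
        a : ℤ
        a = + 3 ℤ.* i ℤ.+ j

      relation₀ : ∀ i → mm i (j ℤ.- + 1) 0 * mm i (j ℤ.+ + 1) 0
                      ≈ coeff (+ 3 ℤ.* i ℤ.+ j) 0 * (mm (i ℤ.- + 1) j 0 * mm (i ℤ.+ + 1) j 0)
      relation₀ i = begin
        inv A * inv B                  ≈⟨ inv-distrib-* A⁻¹ B⁻¹ ⟨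
        inv (A * B)                    ≈⟨ inv-cong (*-invertible A⁻¹ B⁻¹) (relation₁ i) ⟩
        inv (coeff a 1 * (C * D))      ≈⟨ inv-distrib-* (coeff-invertible a 1) (*-invertible C⁻¹ D⁻¹) ⟩
        inv (coeff a 1) * inv (C * D)
          ≈⟨ *-cong (inv-cong (coeff-invertible a 1) (coeff-one a)) (inv-distrib-* C⁻¹ D⁻¹) ⟩
        inv (y a) * (inv C * inv D)    ∎
        where
        a : ℤ
        a = + 3 ℤ.* i ℤ.+ j
        A B C D : Carrier
        A = mm i (j ℤ.- + 1) 1
        B = mm i (j ℤ.+ + 1) 1
        C = mm (i ℤ.- + 1) j 1
        D = mm (i ℤ.+ + 1) j 1
        A⁻¹ : Invertible A
        A⁻¹ = mm-invertible 1 i (j ℤ.- + 1)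
        B⁻¹ : Invertible B
        B⁻¹ = mm-invertible 1 i (j ℤ.+ + 1)
        C⁻¹ : Invertible C
        C⁻¹ = mm-invertible 1 (i ℤ.- + 1) j
        D⁻¹ : Invertible D
        D⁻¹ = mm-invertible 1 (i ℤ.+ + 1) j

    ff-neighbours-in-i : ∀ i j t
      → (mm (i ℤ.- + 1) j t * mm (i ℤ.+ + 1) j t) * (FF (+ 3 ℤ.* i ℤ.+ j ℤ.- + 3) t * FF (+ 3 ℤ.* i ℤ.+ j ℤ.+ + 3) t)
        ≈ ff (i ℤ.- + 1) j t * ff (i ℤ.+ + 1) j t
    ff-neighbours-in-i i j t = begin
      (mm (i ℤ.- + 1) j t * mm (i ℤ.+ + 1) j t) * (FF (a ℤ.- + 3) t * FF (a ℤ.+ + 3) t)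
        ≈⟨ solve 4 (λ a b c d → (a ⊕ b) ⊕ (c ⊕ d) ⊜ (a ⊕ c) ⊕ (b ⊕ d)) refl _ _ _ _ ⟩
      (mm (i ℤ.- + 1) j t * FF (a ℤ.- + 3) t) * (mm (i ℤ.+ + 1) j t * FF (a ℤ.+ + 3) t)
        ≡⟨ P.cong₂ (λ u v → (mm (i ℤ.- + 1) j t * FF u t) * (mm (i ℤ.+ + 1) j t * FF v t))
                   (3[i-1]+j≡3i+j-3 i j) (3[i+1]+j≡3i+j+3 i j) ⟨
      ff (i ℤ.- + 1) j t * ff (i ℤ.+ + 1) j t ∎
      where
      a : ℤ
      a = + 3 ℤ.* i ℤ.+ j

    ff-neighbours-in-j : ∀ i j t
      → (mm (i ℤ.- + 1) j t * mm (i ℤ.+ + 1) j t)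
          * (coeff (+ 3 ℤ.* i ℤ.+ j) t * FF (+ 3 ℤ.* i ℤ.+ j ℤ.- + 1) t * FF (+ 3 ℤ.* i ℤ.+ j ℤ.+ + 1) t)
        ≈ ff i (j ℤ.- + 1) t * ff i (j ℤ.+ + 1) t
    ff-neighbours-in-j i j t = begin
      B * ((coeff a t * FF (a ℤ.- + 1) t) * FF (a ℤ.+ + 1) t)
        ≈⟨ solve 4 (λ b q l r → b ⊕ ((q ⊕ l) ⊕ r) ⊜ (q ⊕ b) ⊕ (l ⊕ r)) refl _ _ _ _ ⟩
      (coeff a t * B) * (FF (a ℤ.- + 1) t * FF (a ℤ.+ + 1) t)
        ≈⟨ *-congʳ (mm-relation j i t) ⟨
      (mm i (j ℤ.- + 1) t * mm i (j ℤ.+ + 1) t) * (FF (a ℤ.- + 1) t * FF (a ℤ.+ + 1) t)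
        ≈⟨ solve 4 (λ a b c d → (a ⊕ b) ⊕ (c ⊕ d) ⊜ (a ⊕ c) ⊕ (b ⊕ d)) refl _ _ _ _ ⟩
      (mm i (j ℤ.- + 1) t * FF (a ℤ.- + 1) t) * (mm i (j ℤ.+ + 1) t * FF (a ℤ.+ + 1) t)
        ≡⟨ P.cong₂ (λ u v → (mm i (j ℤ.- + 1) t * FF u t) * (mm i (j ℤ.+ + 1) t * FF v t))
                   (3i+[j-1]≡3i+j-1 i j) (3i+[j+1]≡3i+j+1 i j) ⟨
      ff i (j ℤ.- + 1) t * ff i (j ℤ.+ + 1) t ∎
      where
      a : ℤ
      a = + 3 ℤ.* i ℤ.+ j
      B : Carrier
      B = mm (i ℤ.- + 1) j t * mm (i ℤ.+ + 1) j t

    ff-octahedron : (∀ j t → ¬ FF j t ≈ 0#) → ∀ i j t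
      → ff i j t * ff i j (suc (suc t))
          ≈ ff (i ℤ.- + 1) j (suc t) * ff (i ℤ.+ + 1) j (suc t)
            + ff i (j ℤ.- + 1) (suc t) * ff i (j ℤ.+ + 1) (suc t)
    ff-octahedron FF≉0 i j t = begin
      (m * F) * ((B * inv m) * ((X + Z) * inv F))
        ≈⟨ solve 6 (λ m F B W m⁻¹ F⁻¹ → (m ⊕ F) ⊕ ((B ⊕ m⁻¹) ⊕ (W ⊕ F⁻¹)) ⊜ (B ⊕ W) ⊕ ((m ⊕ m⁻¹) ⊕ (F ⊕ F⁻¹)))
                   refl m F B (X + Z) (inv m) (inv F) ⟩
      (B * (X + Z)) * ((m * inv m) * (F * inv F))
        ≈⟨ *-congˡ (trans (*-cong (mm-invertible t i j) (inv-inverseʳ F (FF≉0 a t))) (*-identityˡ 1#)) ⟩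
      (B * (X + Z)) * 1#
        ≈⟨ trans (*-identityʳ _) (distribˡ B X Z) ⟩
      B * X + B * Z
        ≈⟨ +-cong (ff-neighbours-in-i i j (suc t)) (ff-neighbours-in-j i j (suc t)) ⟩
      ff (i ℤ.- + 1) j (suc t) * ff (i ℤ.+ + 1) j (suc t)
        + ff i (j ℤ.- + 1) (suc t) * ff i (j ℤ.+ + 1) (suc t) ∎
      where
      a : ℤ
      a = + 3 ℤ.* i ℤ.+ j
      m F B X Z : Carrier
      m = mm i j t
      F = FF a t
      B = mm (i ℤ.- + 1) j (suc t) * mm (i ℤ.+ + 1) j (suc t)
      X = FF (a ℤ.- + 3) (suc t) * FF (a ℤ.+ + 3) (suc t)
      Z = coeff a (suc t) * FF (a ℤ.- + 1) (suc t) * FF (a ℤ.+ + 1) (suc t)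

proposition6p1 : ∀ {c ℓ : Level} (R : CommutativeRing c ℓ)
    → let open CommutativeRing R in
      (inv : Carrier → Carrier)
    → (∀ x → ¬ (x ≈ 0#) → x * inv x ≈ 1#)
    → (n : ℕ) → 1 ℕ.≤ n
    → (y : ℤ → Carrier)
    → let open Octahedron R inv y in
      (∀ (m : ℕ) → ¬ (m ≡ 0) → ¬ (natCast m ≈ 0#))
    → (∀ j → y (j ℤ.+ + (2 ℕ.* n)) ≈ y j)
    → (∀ j → ¬ (y j ≈ 0#))
    → (∀ j t → ¬ (FF j t ≈ 0#))
    → ∀ (i j : ℤ) (t : ℕ)
    → ff i j t * ff i j (suc (suc t))
        ≈ ff (i ℤ.- + 1) j (suc t) * ff (i ℤ.+ + 1) j (suc t)
          + ff i (j ℤ.- + 1) (suc t) * ff i (j ℤ.+ + 1) (suc t)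
proposition6p1 R inv inv-inverseʳ _ _ y _ _ y≉0 FF≉0 =
  OctahedronSolution.ff-octahedron R inv inv-inverseʳ y y≉0 FF≉0
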